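{- Let $n\ge2$ be an integer and let $f$ be a $\gamma_{tr2}(P_2\square P_n)$-function such that the number of vertices $v$ with $f(v)=\emptyset$ is minimum among all $\gamma_{tr2}(P_2\square P_n)$-functions. Then $|f((0,0))|+|f((1,0))|\ge2$ and $|f((0,j))|+|f((1,j))|\ge1$ for each $j\in\{1,\dots,n-1\}$.
   Context: $P_m$ denotes the directed path with vertex set $\{0,1,\dots,m-1\}$ and arcs $(i,i+1)$ for $0\le i\le m-2$. The Cartesian product $D_1\square D_2$ has vertex set $V(D_1)\times V(D_2)$, with an arc from $(x_1,y_1)$ to $(x_2,y_2)$ iff either $(x_1,x_2)$ is an arc of $D_1$ and $y_1=y_2$, or $x_1=x_2$ and $(y_1,y_2)$ is an arc of $D_2$; so vertices of $P_2\square P_n$ are $(i,j)$ with $i\in\{0,1\}$, $j\in\{0,\dots,n-1\}$. For a digraph $D$ and positive integer $k$, a $k$RDF is a function $f:V(D)\to\mathcal{P}(\{1,\dots,k\})$ such that every $v$ with $f(v)=\emptyset$ satisfies $\bigcup_{u\in N^-(v)}f(u)=\{1,\dots,k\}$ ($N^-(v)$ the in-neighbors of $v$); its weight is $\sum_v|f(v)|$. A T$k$RDF is a $k$RDF $f$ such that the subdigraph induced by $\{v:f(v)\neq\emptyset\}$ has no isolated vertex; $\gamma_{trk}(D)$ is the minimum weight of a T$k$RDF, and a T$k$RDF of that weight is a $\gamma_{trk}(D)$-function. -}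

module Defs where

open import Data.Nat using (ℕ; zero; suc; _+_; _≤_)
open import Data.Fin using (Fin; toℕ; zero; suc)
open import Data.Fin.Subset using (Subset; ∣_∣; ⊥; _∈_)
open import Data.Vec.Properties using (≡-dec)
import Data.Bool as B
open import Data.Product using (Σ; _×_; _,_)
open import Data.Sum using (_⊎_)
open import Relation.Binary.PropositionalEquality using (_≡_)
open import Relation.Nullary using (¬_; yes; no)

PathArc : (m : ℕ) → Fin m → Fin m → Set
PathArc m x y = toℕ y ≡ suc (toℕ x)

Vertex : ℕ → Set
Vertex n = Fin 2 × Fin n

Arc : (n : ℕ) → Vertex n → Vertex n → Set
Arc n (x₁ , y₁) (x₂ , y₂) =
  (PathArc 2 x₁ x₂ × y₁ ≡ y₂) ⊎ (x₁ ≡ x₂ × PathArc n y₁ y₂)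

-- A labelling: each vertex gets a subset of the k colours {1,…,k} (as Fin k).
Labelling : ℕ → ℕ → Set
Labelling k n = Vertex n → Subset k

IsRDF : (k n : ℕ) → Labelling k n → Set
IsRDF k n f = (v : Vertex n) → f v ≡ ⊥ →
  (c : Fin k) → Σ (Vertex n) λ u → Arc n u v × c ∈ f u

IsTotalRDF : (k n : ℕ) → Labelling k n → Set
IsTotalRDF k n f = IsRDF k n f ×
  ((v : Vertex n) → ¬ (f v ≡ ⊥) →
     Σ (Vertex n) λ u → ¬ (f u ≡ ⊥) × (Arc n u v ⊎ Arc n v u))

sumFin : (m : ℕ) → (Fin m → ℕ) → ℕ
sumFin zero    g = 0
sumFin (suc m) g = g zero + sumFin m (λ i → g (suc i))

sumV : (n : ℕ) → (Vertex n → ℕ) → ℕ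
sumV n g = sumFin 2 λ i → sumFin n λ j → g (i , j)

weight : (k n : ℕ) → Labelling k n → ℕ
weight k n f = sumV n λ v → ∣ f v ∣

emptyCount : (k n : ℕ) → Labelling k n → ℕ
emptyCount k n f = sumV n λ v → indicator (≡-dec B._≟_ (f v) ⊥)
  where
  indicator : {A : Set} → Relation.Nullary.Dec A → ℕ
  indicator (yes _) = 1
  indicator (no _)  = 0

IsGammaTrFunction : (k n : ℕ) → Labelling k n → Set
IsGammaTrFunction k n f = IsTotalRDF k n f ×
  ((g : Labelling k n) → IsTotalRDF k n g → weight k n f ≤ weight k n g)

-- The vertex (0,0) has no in-neighbour, so it is labelled; if (1,0) is empty, its only
-- in-neighbour (0,0) must carry both colours. If a later column j is empty, the only labelled
-- in-neighbour of (1,j) is (1,j-1), which therefore carries {1,2}, while (1,j) is its only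
-- out-neighbour. Moving colour 2 from (1,j-1) to (1,j) gives a total 2-rainbow dominating
-- function of the same weight with one empty vertex fewer, contradicting the choice of f.
module Submission where

open import Defs
open import Data.Nat using (ℕ; _≤_; _+_)
open import Data.Fin using (Fin; zero; suc; toℕ)
open import Data.Fin.Subset using (∣_∣)
open import Data.Product using (_×_; _,_)
open import Relation.Binary.PropositionalEquality using (_≡_)

open import Data.Nat using (zero; suc; _<_; z≤n; s≤s)
open import Data.Nat.Properties
  using (+-assoc; +-comm; +-identityʳ; +-cancelʳ-≡; +-commutativeSemigroup; suc-injective;
         1+n≢n; n≢0⇒n>0; n≮0; <-≤-trans; ≤-reflexive; +-mono-≤; m<m+n; <⇒≱; ≤-refl; module ≤-Reasoning)
open import Algebra.Properties.CommutativeSemigroup +-commutativeSemigroup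
  using (xy∙z≈xz∙y; x∙yz≈xz∙y)
open import Data.Bool using (if_then_else_)
import Data.Bool as Bool
open import Data.Fin using (inject₁) renaming (_≟_ to _≟ꟳ_)
open import Data.Fin.Properties using (toℕ-injective; toℕ-inject₁)
import Data.Fin.Properties as Fin
open import Data.Fin.Subset using (Subset; _∈_; ⊥; ⊤; ⁅_⁆)
open import Data.Fin.Subset.Properties using (∉⊥; ⊆⊤; ⊆-antisym; Empty-unique; x∈p⇒∣p-x∣<∣p∣)
open import Data.Product using (Σ-syntax; proj₁; proj₂)
open import Data.Product.Properties using (≡-dec)
open import Data.Sum using (_⊎_; inj₁; inj₂)
import Data.Vec.Properties as Vec
open import Data.Empty using (⊥-elim)
open import Function using (_∘_)
open import Relation.Nullary using (¬_; yes; no; does)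
open import Relation.Binary.Definitions using (DecidableEquality)
open import Relation.Binary.PropositionalEquality
  using (_≢_; refl; sym; trans; cong; cong₂; subst; subst₂; module ≡-Reasoning)

sumFin-cong : ∀ {m} {a b : Fin m → ℕ} → (∀ i → a i ≡ b i) → sumFin m a ≡ sumFin m b
sumFin-cong {zero}  a≡b = refl
sumFin-cong {suc m} a≡b = cong₂ _+_ (a≡b zero) (sumFin-cong (a≡b ∘ suc))

sumFin-cong-except : ∀ {m} {a b : Fin m → ℕ} {c d : ℕ} (q : Fin m) →
  (∀ i → i ≢ q → a i ≡ b i) → a q + d ≡ b q + c → sumFin m a + d ≡ sumFin m b + c
sumFin-cong-except {suc m} {a} {b} {c} {d} zero a≡b a+d≡b+c = begin
  a zero + sumFin m (a ∘ suc) + d  ≡⟨ xy∙z≈xz∙y (a zero) _ d ⟩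
  a zero + d + sumFin m (a ∘ suc)  ≡⟨ cong₂ _+_ a+d≡b+c (sumFin-cong (λ i → a≡b (suc i) λ ())) ⟩
  b zero + c + sumFin m (b ∘ suc)  ≡⟨ xy∙z≈xz∙y (b zero) c _ ⟩
  b zero + sumFin m (b ∘ suc) + c  ∎
  where open ≡-Reasoning
sumFin-cong-except {suc m} {a} {b} {c} {d} (suc q) a≡b a+d≡b+c = begin
  a zero + sumFin m (a ∘ suc) + d    ≡⟨ +-assoc (a zero) _ d ⟩
  a zero + (sumFin m (a ∘ suc) + d)  ≡⟨ cong₂ _+_ (a≡b zero λ ()) rest ⟩
  b zero + (sumFin m (b ∘ suc) + c)  ≡⟨ +-assoc (b zero) _ c ⟨
  b zero + sumFin m (b ∘ suc) + c    ∎
  where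
  open ≡-Reasoning
  rest = sumFin-cong-except q (λ i i≢q → a≡b (suc i) (i≢q ∘ Fin.suc-injective)) a+d≡b+c

sumV-cong : ∀ {n} {a b : Vertex n → ℕ} → (∀ v → a v ≡ b v) → sumV n a ≡ sumV n b
sumV-cong a≡b = sumFin-cong λ i → sumFin-cong λ j → a≡b (i , j)

sumV-cong-except : ∀ {n} {a b : Vertex n → ℕ} (w : Vertex n) →
  (∀ v → v ≢ w → a v ≡ b v) → sumV n a + b w ≡ sumV n b + a w
sumV-cong-except {a = a} {b} (i , j) a≡b =
  sumFin-cong-except i
    (λ i′ i′≢i → sumFin-cong λ j′ → a≡b (i′ , j′) (i′≢i ∘ cong proj₁))
    (sumFin-cong-except j (λ j′ j′≢j → a≡b (i , j′) (j′≢j ∘ cong proj₂)) (+-comm (a (i , j)) _))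

_≟ᵛ_ : ∀ {n} → DecidableEquality (Vertex n)
_≟ᵛ_ = ≡-dec _≟ꟳ_ _≟ꟳ_

infixl 6 _[_≔_]
_[_≔_] : ∀ {n} {X : Set} → (Vertex n → X) → Vertex n → X → Vertex n → X
(f [ w ≔ x ]) v with v ≟ᵛ w
... | yes _ = x
... | no  _ = f v

update-here : ∀ {n} {X : Set} (f : Vertex n → X) (w : Vertex n) (x : X) → (f [ w ≔ x ]) w ≡ x
update-here f w x with w ≟ᵛ w
... | yes _   = refl
... | no  w≢w = ⊥-elim (w≢w refl)

update-elsewhere : ∀ {n} {X : Set} (f : Vertex n → X) {w v : Vertex n} {x : X} →
  v ≢ w → (f [ w ≔ x ]) v ≡ f v
update-elsewhere f {w} {v} v≢w with v ≟ᵛ w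
... | yes v≡w = ⊥-elim (v≢w v≡w)
... | no  _   = refl

sumV-update : ∀ {n} {X : Set} (h : X → ℕ) (f : Vertex n → X) (w : Vertex n) (x : X) →
  sumV n (h ∘ (f [ w ≔ x ])) + h (f w) ≡ sumV n (h ∘ f) + h x
sumV-update {n} h f w x = trans
  (sumV-cong-except w λ v v≢w → cong h (update-elsewhere f v≢w))
  (cong (λ y → sumV n (h ∘ f) + h y) (update-here f w x))

isEmpty : ∀ {k} → Subset k → ℕ
isEmpty s = if does (Vec.≡-dec Bool._≟_ s ⊥) then 1 else 0

-- The summand of emptyCount is local to Defs; it is read off the one-column grid whose other
-- vertex is labelled ⁅ zero ⁆, where emptyCount reduces to that summand + 0 + 0.
column : ∀ {k} → Subset k → Subset k → Labelling k 1
column s t (zero , _)     = s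
column s t (suc zero , _) = t

emptyCount-column : ∀ {k} (s : Subset (suc k)) →
  emptyCount (suc k) 1 (column s ⁅ zero ⁆) ≡ isEmpty s + 0 + 0
emptyCount-column s with Vec.≡-dec Bool._≟_ s ⊥
... | yes _ = refl
... | no  _ = refl

emptyCount≡sumV-isEmpty : ∀ {k n} (f : Labelling (suc k) n) →
  emptyCount (suc k) n f ≡ sumV n (isEmpty ∘ f)
emptyCount≡sumV-isEmpty f = sumV-cong λ v → drop-+0+0 (emptyCount-column (f v))
  where
  drop-+0+0 : ∀ {a b} → a + 0 + 0 ≡ b + 0 + 0 → a ≡ b
  drop-+0+0 e = +-cancelʳ-≡ 0 _ _ (+-cancelʳ-≡ 0 _ _ e)

∣p∣≡0⇒p≡⊥ : ∀ {k} {p : Subset k} → ∣ p ∣ ≡ 0 → p ≡ ⊥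
∣p∣≡0⇒p≡⊥ ∣p∣≡0 =
  Empty-unique λ (_ , x∈p) → n≮0 (<-≤-trans (x∈p⇒∣p-x∣<∣p∣ x∈p) (≤-reflexive ∣p∣≡0))

p≢⊥⇒0<∣p∣ : ∀ {k} {p : Subset k} → p ≢ ⊥ → 0 < ∣ p ∣
p≢⊥⇒0<∣p∣ p≢⊥ = n≢0⇒n>0 (p≢⊥ ∘ ∣p∣≡0⇒p≡⊥)

0<∣p∣+∣q∣ : ∀ {k} {p q : Subset k} → ¬ (p ≡ ⊥ × q ≡ ⊥) → 0 < ∣ p ∣ + ∣ q ∣
0<∣p∣+∣q∣ {p = p} {q} ¬both⊥ with ∣ p ∣ in ∣p∣≡ | ∣ q ∣ in ∣q∣≡
... | suc _ | _     = s≤s z≤n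
... | zero  | suc _ = s≤s z≤n
... | zero  | zero  = ⊥-elim (¬both⊥ (∣p∣≡0⇒p≡⊥ ∣p∣≡ , ∣p∣≡0⇒p≡⊥ ∣q∣≡))

PathArc-irrefl : ∀ {m} {x : Fin m} → ¬ PathArc m x x
PathArc-irrefl = 1+n≢n ∘ sym

PathArc-functional : ∀ {m} {x y z : Fin m} → PathArc m x y → PathArc m x z → y ≡ z
PathArc-functional x→y x→z = toℕ-injective (trans x→y (sym x→z))

PathArc-injective : ∀ {m} {x y z : Fin m} → PathArc m x z → PathArc m y z → x ≡ y
PathArc-injective x→z y→z = toℕ-injective (suc-injective (trans (sym x→z) y→z))

PathArc-inject₁ : ∀ {m} (j : Fin m) → PathArc (suc m) (inject₁ j) (suc j)
PathArc-inject₁ j = cong suc (sym (toℕ-inject₁ j))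

Arc-irrefl : ∀ {n} {v : Vertex n} → ¬ Arc n v v
Arc-irrefl (inj₁ (x→x , _)) = PathArc-irrefl x→x
Arc-irrefl (inj₂ (_ , y→y)) = PathArc-irrefl y→y

origin-noInArc : ∀ {n} (u : Vertex (suc n)) → ¬ Arc (suc n) u (zero , zero)
origin-noInArc u (inj₁ (() , _))
origin-noInArc u (inj₂ (_ , ()))

inArc-row₁ : ∀ {n} {y : Fin n} (u : Vertex n) → Arc n u (suc zero , y) →
  u ≡ (zero , y) ⊎ Σ[ x ∈ Fin n ] u ≡ (suc zero , x) × PathArc n x y
inArc-row₁ (zero , _)     (inj₁ (_ , refl))    = inj₁ refl
inArc-row₁ (zero , _)     (inj₂ (() , _))
inArc-row₁ (suc zero , _) (inj₁ (() , _))
inArc-row₁ (suc zero , x) (inj₂ (refl , x→y)) = inj₂ (x , refl , x→y)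

outArc-row₁ : ∀ {n} {x : Fin n} (v : Vertex n) → Arc n (suc zero , x) v →
  Σ[ y ∈ Fin n ] v ≡ (suc zero , y) × PathArc n x y
outArc-row₁ (zero , _)     (inj₁ (() , _))
outArc-row₁ (zero , _)     (inj₂ (() , _))
outArc-row₁ (suc zero , _) (inj₁ (() , _))
outArc-row₁ (suc zero , y) (inj₂ (refl , x→y)) = y , refl , x→y

IsRDF-nonempty-source : ∀ {k n} {f : Labelling (suc k) n} {v : Vertex n} → IsRDF (suc k) n f →
  (∀ u → ¬ Arc n u v) → f v ≢ ⊥
IsRDF-nonempty-source {v = v} rdf noInArc fv≡⊥ with rdf v fv≡⊥ zero
... | u , u→v , _ = noInArc u u→v

IsRDF-sole-supplier : ∀ {k n} {f : Labelling k n} {v w : Vertex n} → IsRDF k n f → f v ≡ ⊥ →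
  (∀ u → Arc n u v → u ≡ w ⊎ f u ≡ ⊥) → f w ≡ ⊤
IsRDF-sole-supplier {f = f} {v} {w} rdf fv≡⊥ sole = ⊆-antisym ⊆⊤ λ {c} _ → supplies c
  where
  supplies : ∀ c → c ∈ f w
  supplies c with rdf v fv≡⊥ c
  ... | u , u→v , c∈fu with sole u u→v
  ...   | inj₁ refl  = c∈fu
  ...   | inj₂ fu≡⊥ = ⊥-elim (∉⊥ (subst (c ∈_) fu≡⊥ c∈fu))

module Split {k n : ℕ} (f : Labelling k n) {A B : Vertex n} (A→B : Arc n A B)
  (only-B : ∀ v → Arc n A v → v ≡ B) (fB≡⊥ : f B ≡ ⊥)
  (p q : Subset k) (p≢⊥ : p ≢ ⊥) (q≢⊥ : q ≢ ⊥) where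

  split : Labelling k n
  split = f [ A ≔ p ] [ B ≔ q ]

  A≢B : A ≢ B
  A≢B refl = Arc-irrefl A→B

  split-A : split A ≡ p
  split-A = trans (update-elsewhere _ A≢B) (update-here f A p)

  split-B : split B ≡ q
  split-B = update-here _ B q

  split-elsewhere : ∀ {v} → v ≢ A → v ≢ B → split v ≡ f v
  split-elsewhere v≢A v≢B = trans (update-elsewhere _ v≢B) (update-elsewhere f v≢A)

  A-or-B-or-elsewhere : ∀ v → v ≡ A ⊎ v ≡ B ⊎ (v ≢ A × v ≢ B)
  A-or-B-or-elsewhere v with v ≟ᵛ A | v ≟ᵛ B
  ... | yes v≡A | _       = inj₁ v≡A
  ... | no _    | yes v≡B = inj₂ (inj₁ v≡B)
  ... | no v≢A  | no v≢B  = inj₂ (inj₂ (v≢A , v≢B))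

  split-nonempty : ∀ v → f v ≢ ⊥ → split v ≢ ⊥
  split-nonempty v fv≢⊥ with A-or-B-or-elsewhere v
  ... | inj₁ refl                = p≢⊥ ∘ trans (sym split-A)
  ... | inj₂ (inj₁ refl)         = q≢⊥ ∘ trans (sym split-B)
  ... | inj₂ (inj₂ (v≢A , v≢B)) = fv≢⊥ ∘ trans (sym (split-elsewhere v≢A v≢B))

  split-isRDF : IsRDF k n f → IsRDF k n split
  split-isRDF rdf v sv≡⊥ c with A-or-B-or-elsewhere v
  ... | inj₁ refl                = ⊥-elim (p≢⊥ (trans (sym split-A) sv≡⊥))
  ... | inj₂ (inj₁ refl)         = ⊥-elim (q≢⊥ (trans (sym split-B) sv≡⊥))
  ... | inj₂ (inj₂ (v≢A , v≢B)) with rdf v (trans (sym (split-elsewhere v≢A v≢B)) sv≡⊥) c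
  ...   | u , u→v , c∈fu = u , u→v , subst (c ∈_) (sym (split-elsewhere u≢A u≢B)) c∈fu
    where
    u≢A : u ≢ A
    u≢A refl = v≢B (only-B v u→v)
    u≢B : u ≢ B
    u≢B refl = ∉⊥ (subst (c ∈_) fB≡⊥ c∈fu)

  split-isTotalRDF : IsTotalRDF k n f → IsTotalRDF k n split
  split-isTotalRDF (rdf , total) = split-isRDF rdf , split-total
    where
    split-total : ∀ v → split v ≢ ⊥ →
      Σ[ u ∈ Vertex n ] split u ≢ ⊥ × (Arc n u v ⊎ Arc n v u)
    split-total v sv≢⊥ with A-or-B-or-elsewhere v
    ... | inj₁ refl                = B , q≢⊥ ∘ trans (sym split-B) , inj₂ A→B
    ... | inj₂ (inj₁ refl)         = A , p≢⊥ ∘ trans (sym split-A) , inj₁ A→B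
    ... | inj₂ (inj₂ (v≢A , v≢B)) with total v (sv≢⊥ ∘ trans (split-elsewhere v≢A v≢B))
    ...   | u , fu≢⊥ , adjacent = u , split-nonempty u fu≢⊥ , adjacent

  sumV-split : (h : Subset k → ℕ) →
    sumV n (h ∘ split) + (h (f A) + h (f B)) ≡ sumV n (h ∘ f) + (h p + h q)
  sumV-split h = begin
    S split + (h (f A) + h (f B))           ≡⟨ x∙yz≈xz∙y (S split) _ _ ⟩
    S split + h (f B) + h (f A)             ≡⟨ cong (λ s → S split + h s + h (f A))
                                                    (update-elsewhere f (A≢B ∘ sym)) ⟨
    S split + h ((f [ A ≔ p ]) B) + h (f A) ≡⟨ cong (_+ h (f A)) (sumV-update h _ B q) ⟩
    S (f [ A ≔ p ]) + h q + h (f A)         ≡⟨ xy∙z≈xz∙y (S (f [ A ≔ p ])) _ _ ⟩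
    S (f [ A ≔ p ]) + h (f A) + h q         ≡⟨ cong (_+ h q) (sumV-update h f A p) ⟩
    S f + h p + h q                         ≡⟨ +-assoc (S f) _ _ ⟩
    S f + (h p + h q)                       ∎
    where
    open ≡-Reasoning
    S : Labelling k n → ℕ
    S g = sumV n (h ∘ g)

first-column-weight : ∀ {m} {f : Labelling 2 (suc m)} → IsRDF 2 (suc m) f →
  2 ≤ ∣ f (zero , zero) ∣ + ∣ f (suc zero , zero) ∣
first-column-weight {m} {f} rdf with ∣ f (suc zero , zero) ∣ in ∣f₁₀∣≡
... | suc _ = +-mono-≤ (p≢⊥⇒0<∣p∣ (IsRDF-nonempty-source rdf origin-noInArc)) (s≤s z≤n)
... | zero  = subst (λ s → 2 ≤ ∣ s ∣ + 0) (sym f₀₀≡⊤) ≤-refl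
  where
  only-origin : ∀ u → Arc (suc m) u (suc zero , zero) → u ≡ (zero , zero) ⊎ f u ≡ ⊥
  only-origin u u→v with inArc-row₁ u u→v
  ... | inj₁ u≡origin = inj₁ u≡origin
  ... | inj₂ (_ , _ , ())
  f₀₀≡⊤ : f (zero , zero) ≡ ⊤
  f₀₀≡⊤ = IsRDF-sole-supplier rdf (∣p∣≡0⇒p≡⊥ ∣f₁₀∣≡) only-origin

empty-column-split : ∀ {m} {f : Labelling 2 (suc m)} → IsTotalRDF 2 (suc m) f → (j : Fin m) →
  f (zero , suc j) ≡ ⊥ → f (suc zero , suc j) ≡ ⊥ →
  Σ[ g ∈ Labelling 2 (suc m) ] IsTotalRDF 2 (suc m) g
    × weight 2 (suc m) g ≡ weight 2 (suc m) f × emptyCount 2 (suc m) g < emptyCount 2 (suc m) f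
empty-column-split {m} {f} total j f₀ⱼ≡⊥ f₁ⱼ≡⊥ =
  split , split-isTotalRDF total , same-weight , fewer-empty
  where
  A B : Vertex (suc m)
  A = (suc zero , inject₁ j)
  B = (suc zero , suc j)

  only-B : ∀ v → Arc (suc m) A v → v ≡ B
  only-B v A→v with outArc-row₁ v A→v
  ... | _ , refl , x→y = cong (suc zero ,_) (PathArc-functional x→y (PathArc-inject₁ j))

  B-supplier : ∀ u → Arc (suc m) u B → u ≡ A ⊎ f u ≡ ⊥
  B-supplier u u→B with inArc-row₁ u u→B
  ... | inj₁ refl             = inj₂ f₀ⱼ≡⊥
  ... | inj₂ (_ , refl , x→y) =
    inj₁ (cong (suc zero ,_) (PathArc-injective x→y (PathArc-inject₁ j)))

  fA≡⊤ : f A ≡ ⊤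
  fA≡⊤ = IsRDF-sole-supplier (proj₁ total) f₁ⱼ≡⊥ B-supplier

  open Split f (inj₂ (refl , PathArc-inject₁ j)) only-B f₁ⱼ≡⊥ ⁅ zero ⁆ ⁅ suc zero ⁆ (λ ()) (λ ())

  same-weight : weight 2 (suc m) split ≡ weight 2 (suc m) f
  same-weight = +-cancelʳ-≡ 2 _ _
    (subst₂ (λ a b → weight 2 (suc m) split + (∣ a ∣ + ∣ b ∣) ≡ weight 2 (suc m) f + 2)
            fA≡⊤ f₁ⱼ≡⊥ (sumV-split ∣_∣))

  fewer-empty : emptyCount 2 (suc m) split < emptyCount 2 (suc m) f
  fewer-empty = begin-strict
    emptyCount 2 (suc m) split          ≡⟨ emptyCount≡sumV-isEmpty split ⟩
    sumV (suc m) (isEmpty ∘ split)      <⟨ m<m+n _ (s≤s z≤n) ⟩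
    sumV (suc m) (isEmpty ∘ split) + 1  ≡⟨ split-count ⟩
    sumV (suc m) (isEmpty ∘ f) + 0      ≡⟨ +-identityʳ _ ⟩
    sumV (suc m) (isEmpty ∘ f)          ≡⟨ emptyCount≡sumV-isEmpty f ⟨
    emptyCount 2 (suc m) f              ∎
    where
    open ≤-Reasoning
    split-count = subst₂ (λ a b → sumV (suc m) (isEmpty ∘ split) + (isEmpty a + isEmpty b)
                                    ≡ sumV (suc m) (isEmpty ∘ f) + 0)
                         fA≡⊤ f₁ⱼ≡⊥ (sumV-split isEmpty)

lemma4p1 : (n : ℕ) → 2 ≤ n → (f : Labelling 2 n) →
    IsGammaTrFunction 2 n f →
    ((g : Labelling 2 n) → IsGammaTrFunction 2 n g →
       emptyCount 2 n f ≤ emptyCount 2 n g) →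
    ((j : Fin n) → toℕ j ≡ 0 → 2 ≤ ∣ f (zero , j) ∣ + ∣ f (suc zero , j) ∣)
    × ((j : Fin n) → 1 ≤ toℕ j → 1 ≤ ∣ f (zero , j) ∣ + ∣ f (suc zero , j) ∣)
lemma4p1 (suc m) _ f (total , minimal-weight) minimal-empty = first-column , later-column
  where
  first-column : (j : Fin (suc m)) → toℕ j ≡ 0 → 2 ≤ ∣ f (zero , j) ∣ + ∣ f (suc zero , j) ∣
  first-column zero _ = first-column-weight (proj₁ total)

  no-empty-column : (j : Fin m) → ¬ (f (zero , suc j) ≡ ⊥ × f (suc zero , suc j) ≡ ⊥)
  no-empty-column j (f₀ⱼ≡⊥ , f₁ⱼ≡⊥) with empty-column-split total j f₀ⱼ≡⊥ f₁ⱼ≡⊥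
  ... | g , g-total , same-weight , fewer-empty =
    <⇒≱ fewer-empty (minimal-empty g (g-total , λ h h-total →
      subst (_≤ weight 2 (suc m) h) (sym same-weight) (minimal-weight h h-total)))

  later-column : (j : Fin (suc m)) → 1 ≤ toℕ j → 1 ≤ ∣ f (zero , j) ∣ + ∣ f (suc zero , j) ∣
  later-column (suc j) _ = 0<∣p∣+∣q∣ (no-empty-column j)
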